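{- Every augmented web $W\in AW(n,d)$ is a reduced normal plabic graph.
   Context: A normal plabic graph is a planar graph embedded in a closed disk (loops/multiple edges allowed) with $n$ boundary vertices labelled $1,\dots,n$ clockwise, each incident to exactly one edge, and interior vertices coloured black or white, such that white vertices have degree $3$, boundary vertices are adjacent only to black vertices, and no edge joins two interior vertices of the same colour. An augmented web is one with no interior face (not meeting the boundary circle) of degree $<6$ and no black vertex of degree $<3$; its exceedance is #black − #white; $AW(n,d)$ is the set of augmented webs with $n$ boundary vertices and exceedance $d$. Moves: (normal urban renewal) if there is a square face with white vertices $w_1,w_2$ and black vertices $x,y$, where $w_1$ has third neighbour $t$ and $w_2$ third neighbour $s$ (black), replace $w_1,w_2$ by white vertices $w_1'$ adjacent to $x,t,s$ and $w_2'$ adjacent to $y,t,s$, creating the square face $t w_1' s w_2'$ (planarly). (Normal flip) if a black vertex $m$ has degree $2$ with white neighbours $w_1$ (other neighbours $t,r$) and $w_2$ (other neighbours $l,s$), arranged so that around the configuration the outer vertices appear in cyclic order $t,r,s,l$, replace $w_1,w_2$ by white $w_1'$ adjacent to $t,l,m$ and $w_2'$ adjacent to $m,r,s$. Two normal plabic graphs are move equivalent if related by a sequence of such moves. A normal plabic graph is reduced if it is not move equivalent to any plabic graph containing a face of degree two or a leaf (degree-one) vertex not adjacent to the boundary. -}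

module Defs where

-- Normal plabic graphs in a disk, encoded combinatorially as a rotation
-- system (combinatorial map) of the graph TOGETHER WITH the boundary circle.

open import Data.Nat using (ℕ; zero; suc; _+_; _≤_; _<_; _≤ᵇ_)
open import Data.Fin using (Fin; toℕ; _≟_)
open import Data.Bool using (Bool; true; false; if_then_else_; _∧_; _∨_)
open import Data.List using (List; length; map; upTo; filterᵇ)
open import Data.Bool.ListAction using (and)
open import Data.Fin.Base using ()
open import Data.List.Base using ()
open import Data.Integer using (ℤ; +_; _-_)
open import Data.Product using (Σ; _×_; ∃; ∃-syntax; _,_)
open import Data.Sum using (_⊎_)
open import Relation.Nullary using (¬_)
open import Relation.Nullary.Decidable using (⌊_⌋)
open import Relation.Binary.PropositionalEquality using (_≡_; _≢_)
open import Relation.Binary.Construct.Closure.ReflexiveTransitive using (Star)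
open import Relation.Binary.Construct.Closure.Equivalence using (EqClosure)
open import Function.Bundles using (_↔_; Inverse)
import Data.List.Base as L

iter : {A : Set} → (A → A) → ℕ → A → A
iter f zero    x = x
iter f (suc k) x = f (iter f k x)

_==_ : {m : ℕ} → Fin m → Fin m → Bool
x == y = ⌊ x ≟ y ⌋

OrbitLen : {m : ℕ} → (Fin m → Fin m) → Fin m → ℕ → Set
OrbitLen p x k = (0 < k) × (iter p k x ≡ x) × (∀ j → 0 < j → j < k → iter p j x ≢ x)

isOrbitRep : {m : ℕ} → (Fin m → Fin m) → Fin m → Bool
isOrbitRep {m} p x = and (map (λ k → toℕ x ≤ᵇ toℕ (iter p k x)) (upTo m))

allFin : (m : ℕ) → List (Fin m)
allFin m = L.tabulate (λ i → i)

countOrbits : {m : ℕ} → (Fin m → Fin m) → (Fin m → Bool) → ℕ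
countOrbits {m} p P = length (filterᵇ (λ x → isOrbitRep p x ∧ P x) (allFin m))

-- Vertex kinds.  bdry i is the boundary vertex with label (toℕ i + 1);
-- marker is an auxiliary degree-2 vertex on the boundary circle between
-- boundary vertices n and 1.

data Kind (n : ℕ) : Set where
  marker : Kind n
  bdry   : Fin n → Kind n
  black  : Kind n
  white  : Kind n

onCircle : {n : ℕ} → Kind n → Bool
onCircle marker   = true
onCircle (bdry _) = true
onCircle black    = false
onCircle white    = false

isBlack : {n : ℕ} → Kind n → Bool
isBlack black = true
isBlack _     = false

isWhite : {n : ℕ} → Kind n → Bool
isWhite white = true
isWhite _     = false

-- Darts = half-edges Fin m.  σ = clockwise rotation around vertices,
-- α = edge involution, vertices = σ-orbits, edges = α-orbits,
-- faces = orbits of φ = σ ∘ α.  The map includes the boundary circle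
-- (edges between consecutive boundary vertices / the marker).

record PlabicGraph (n : ℕ) : Set where
  field
    m     : ℕ
    σ     : Fin m → Fin m
    σ⁻    : Fin m → Fin m
    α     : Fin m → Fin m
    kind  : Fin m → Kind n
    μ     : Fin m
    bd    : Fin n → Fin m

    σσ⁻      : ∀ d → σ (σ⁻ d) ≡ d
    σ⁻σ      : ∀ d → σ⁻ (σ d) ≡ d
    α-invol  : ∀ d → α (α d) ≡ d
    α-nofix  : ∀ d → α d ≢ d
    kind-σ   : ∀ d → kind (σ d) ≡ kind d

    μ-kind   : kind μ ≡ marker
    μ-deg    : OrbitLen σ μ 2
    μ-unique : ∀ d → kind d ≡ marker → (d ≡ μ) ⊎ (d ≡ σ μ)

    -- boundary vertex i: unique, degree 3 in the extended map; clockwise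
    -- its darts are: graph dart bd i, circle dart towards i-1, circle dart
    -- towards i+1 (labels clockwise)
    bd-kind   : ∀ i → kind (bd i) ≡ bdry i
    bd-deg    : ∀ i → OrbitLen σ (bd i) 3
    bd-unique : ∀ i d → kind d ≡ bdry i →
                (d ≡ bd i) ⊎ ((d ≡ σ (bd i)) ⊎ (d ≡ σ (σ (bd i))))
    circle-next  : ∀ (i j : Fin n) → toℕ j ≡ suc (toℕ i) →
                   α (σ (σ (bd i))) ≡ σ (bd j)
    circle-first : ∀ (i : Fin n) → toℕ i ≡ 0 → α (σ μ) ≡ σ (bd i)
    circle-last  : ∀ (i : Fin n) → suc (toℕ i) ≡ n → α μ ≡ σ (σ (bd i))
    circle-empty : n ≡ 0 → α μ ≡ σ μ

    bd-black    : ∀ i → kind (α (bd i)) ≡ black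
    white-deg   : ∀ d → kind d ≡ white → OrbitLen σ d 3
    white-black : ∀ d → kind d ≡ white → kind (α d) ≡ black
    black-nb    : ∀ d → kind d ≡ black → kind (α d) ≢ black

    -- planarity in the disk: the extended map is connected and has genus 0
    connected : ∀ d e → Star (λ x y → (y ≡ σ x) ⊎ (y ≡ α x)) d e
    euler     : countOrbits σ (λ _ → true) + countOrbits (λ d → σ (α d)) (λ _ → true)
                ≡ 2 + countOrbits α (λ _ → true)

module _ {n : ℕ} (G : PlabicGraph n) where
  open PlabicGraph G

  φ : Fin m → Fin m
  φ d = σ (α d)

  isCircleDart : Fin m → Bool
  isCircleDart d = onCircle (kind d) ∧ onCircle (kind (α d))

  InteriorFace : Fin m → Set
  InteriorFace d = ∀ k → isCircleDart (iter φ k d) ≡ false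

  IsInteriorKind : Kind n → Set
  IsInteriorKind k = (k ≡ black) ⊎ (k ≡ white)

  exceedance : ℤ
  exceedance = + countOrbits σ (λ d → isBlack (kind d))
             - + countOrbits σ (λ d → isWhite (kind d))

  IsAugmentedWeb : Set
  IsAugmentedWeb =
    (∀ d k → InteriorFace d → OrbitLen φ d k → 6 ≤ k) ×
    (∀ d k → kind d ≡ black → OrbitLen σ d k → 3 ≤ k)

  HasDegTwoFace : Set
  HasDegTwoFace = ∃[ d ] (InteriorFace d × OrbitLen φ d 2)

  HasInteriorLeaf : Set
  HasInteriorLeaf = ∃[ d ] (IsInteriorKind (kind d) × (σ d ≡ d) × (onCircle (kind (α d)) ≡ false))

AW : (n : ℕ) → ℤ → PlabicGraph n → Set
AW n e W = IsAugmentedWeb W × (exceedance W ≡ e)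

-- Moves.  G' is obtained from G by replacing σ, α, kind by σ₀, α₀, kind₀
-- on the same dart set, up to relabelling of darts.

Realizes : {n : ℕ} (G G' : PlabicGraph n) →
           (Fin (PlabicGraph.m G) → Fin (PlabicGraph.m G)) →
           (Fin (PlabicGraph.m G) → Fin (PlabicGraph.m G)) →
           (Fin (PlabicGraph.m G) → Kind n) → Set
Realizes G G' σ₀ α₀ kind₀ =
  Σ (Fin (PlabicGraph.m G) ↔ Fin (PlabicGraph.m G')) λ β →
    let b = Inverse.to β in
    ∀ d → (PlabicGraph.σ G' (b d) ≡ b (σ₀ d)) ×
          (PlabicGraph.α G' (b d) ≡ b (α₀ d)) ×
          (PlabicGraph.kind G' (b d) ≡ kind₀ d)

module _ {n : ℕ} (G : PlabicGraph n) where
  open PlabicGraph G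

  -- Urban renewal at the square face p (w₁→x), e2 (x→w₂), e3 (w₂→y), e4 (y→w₁).
  module UR (p : Fin m) where
    q  = α p
    e2 = σ q
    r  = α e2
    e3 = σ r
    u  = α e3
    e4 = σ u
    v  = α e4
    a  = σ p
    a' = α a
    b  = σ e3
    b' = α b

    URCondition : Set
    URCondition = (kind p ≡ white) × (kind r ≡ white) × (σ v ≡ p) ×
                  (r ≢ p) × (r ≢ a) × (r ≢ v)

    skip : Fin m → Fin m
    skip c = if c == e2 then σ e2 else (if c == e4 then σ e4 else c)

    ins : Fin m → Fin m
    ins c = if c == a' then e2 else (if c == b' then e4 else c)

    σ₀ : Fin m → Fin m
    σ₀ d =
      if d == p then a else
      if d == a then r else
      if d == r then p else
      if d == e3 then b else
      if d == b then v else
      if d == v then e3 else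
      if d == e2 then a' else
      if d == e4 then b' else
      ins (skip (σ d))

    α₀ : Fin m → Fin m
    α₀ d =
      if d == p then q else if d == q then p else
      if d == a then a' else if d == a' then a else
      if d == r then e4 else if d == e4 then r else
      if d == e3 then u else if d == u then e3 else
      if d == b then b' else if d == b' then b else
      if d == v then e2 else if d == e2 then v else
      α d

    kind₀ : Fin m → Kind n
    kind₀ d =
      if (d == p ∨ d == a ∨ d == r ∨ d == e3 ∨ d == b ∨ d == v) then white else
      if d == e2 then kind a' else
      if d == e4 then kind b' else
      kind d

  UrbanRenewal : PlabicGraph n → Set
  UrbanRenewal G' = ∃[ p ] (UR.URCondition p × Realizes G G' (UR.σ₀ p) (UR.α₀ p) (UR.kind₀ p))

  module FL (m1 : Fin m) where
    m2 = σ m1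
    c1 = α m1
    c2 = α m2
    dt = σ c1
    dr = σ dt
    ds = σ c2
    dl = σ ds

    FlipCondition : Set
    FlipCondition = (kind m1 ≡ black) × OrbitLen σ m1 2 ×
                    (kind c1 ≡ white) × (kind c2 ≡ white) ×
                    (c2 ≢ c1) × (c2 ≢ dt) × (c2 ≢ dr)

    σ₀ : Fin m → Fin m
    σ₀ d =
      if d == c1 then dl else
      if d == dl then dt else
      if d == dt then c1 else
      if d == c2 then dr else
      if d == dr then ds else
      if d == ds then c2 else
      σ d

  Flip : PlabicGraph n → Set
  Flip G' = ∃[ m1 ] (FL.FlipCondition m1 × Realizes G G' (FL.σ₀ m1) α kind)

Move : {n : ℕ} → PlabicGraph n → PlabicGraph n → Set
Move G G' = UrbanRenewal G G' ⊎ Flip G G'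

MoveEquivalent : {n : ℕ} → PlabicGraph n → PlabicGraph n → Set
MoveEquivalent = EqClosure Move

Reduced : {n : ℕ} → PlabicGraph n → Set
Reduced G = ∀ G' → MoveEquivalent G G' → ¬ (HasDegTwoFace G' ⊎ HasInteriorLeaf G')

{-# OPTIONS --safe #-}
module Submission where

-- An augmented web admits no move at all, in either direction.  Urban
-- renewal needs a square face before the move and leaves one after it;
-- a flip needs a black vertex of degree 2 and keeps it.  An augmented web
-- has neither (interior faces have degree ≥ 6, black vertices degree ≥ 3),
-- so its move-equivalence class is just itself, and it has no face of
-- degree 2 and no interior leaf for the same degree reasons.

open import Defs
open import Data.Nat using (ℕ; zero; suc; _≤_; _<_; z≤n; s≤s; z<s)
open import Data.Nat.Properties using (≤-refl; ≤-trans; <⇒≤; 1+n≰n; _<?_; m≤n⇒m<n∨m≡n; anyUpTo?)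
open import Data.Nat.Induction using (<-rec)
open import Data.Integer using (ℤ)
open import Data.Fin using (Fin; _≟_)
open import Data.Bool using (true; false)
open import Data.Bool.Properties using (∧-zeroʳ)
open import Data.Product using (∃-syntax; _×_; _,_; proj₁; proj₂)
open import Data.Sum using (_⊎_; inj₁; inj₂; [_,_])
open import Data.Empty using (⊥; ⊥-elim)
open import Function using (_∘_)
open import Function.Bundles using (Inverse; Injection)
open import Function.Properties.Inverse using (↔⇒↣)
open import Relation.Nullary using (¬_; yes; no)
open import Relation.Nullary.Decidable using (isYes≗does; dec-true; dec-false; _×-dec_)
open import Relation.Binary.PropositionalEquality using (_≡_; _≢_; refl; sym; trans; cong; ≢-sym)
open import Relation.Binary.Construct.Closure.ReflexiveTransitive using (ε; _◅_)
open import Relation.Binary.Construct.Closure.Symmetric using (SymClosure; fwd; bwd)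

==-refl : ∀ {k} (x : Fin k) → (x == x) ≡ true
==-refl x = trans (isYes≗does (x ≟ x)) (dec-true (x ≟ x) refl)

≢⇒==-false : ∀ {k} {x y : Fin k} → x ≢ y → (x == y) ≡ false
≢⇒==-false {x = x} {y} x≢y = trans (isYes≗does (x ≟ y)) (dec-false (x ≟ y) x≢y)

module _ {A : Set} (f : A → A) where

  iter-periodic : ∀ {p x} → 0 < p → iter f p x ≡ x →
                  ∀ k → ∃[ j ] (j < p × iter f k x ≡ iter f j x)
  iter-periodic 0<p fixed zero = 0 , 0<p , refl
  iter-periodic 0<p fixed (suc k) with iter-periodic 0<p fixed k
  ... | j , j<p , eq with m≤n⇒m<n∨m≡n j<p
  ...   | inj₁ 1+j<p = suc j , 1+j<p , cong f eq
  ...   | inj₂ refl  = 0 , 0<p , trans (cong f eq) fixed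

  module _ {B : Set} {g : B → B} (h : A → B) (comm : ∀ x → g (h x) ≡ h (f x)) where

    iter-conj : ∀ k x → iter g k (h x) ≡ h (iter f k x)
    iter-conj zero    x = refl
    iter-conj (suc k) x = trans (cong g (iter-conj k x)) (comm (iter f k x))

  module _ (f-injective : ∀ {x y} → f x ≡ f y → x ≡ y) {x : A} (f³x≡x : f (f (f x)) ≡ x) where

    OnTriangle : A → Set
    OnTriangle y = (y ≡ x) ⊎ (y ≡ f x) ⊎ (y ≡ f (f x))

    onTriangle-pred : ∀ {y} → OnTriangle (f y) → OnTriangle y
    onTriangle-pred (inj₁ fy≡x)          = inj₂ (inj₂ (f-injective (trans fy≡x (sym f³x≡x))))
    onTriangle-pred (inj₂ (inj₁ fy≡fx))  = inj₁ (f-injective fy≡fx)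
    onTriangle-pred (inj₂ (inj₂ fy≡ffx)) = inj₂ (inj₁ (f-injective fy≡ffx))

module _ {m : ℕ} (f : Fin m → Fin m) where

  orbitLen-≤ : ∀ {x} p → 0 < p → iter f p x ≡ x → ∃[ k ] (k ≤ p × OrbitLen f x k)
  orbitLen-≤ {x} = <-rec _ shortest
    where
    shortest : ∀ p → (∀ {q} → q < p → 0 < q → iter f q x ≡ x → ∃[ k ] (k ≤ q × OrbitLen f x k)) →
               0 < p → iter f p x ≡ x → ∃[ k ] (k ≤ p × OrbitLen f x k)
    shortest p rec 0<p fixed with anyUpTo? (λ j → 0 <? j ×-dec iter f j x ≟ x) p
    ... | no earlier =
      p , ≤-refl , 0<p , fixed , λ j 0<j j<p fixed-j → earlier (j , j<p , 0<j , fixed-j)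
    ... | yes (q , q<p , 0<q , fixed-q) with rec q<p 0<q fixed-q
    ...   | k , k≤q , orbit = k , ≤-trans k≤q (<⇒≤ q<p) , orbit

  OrbitLen-one : ∀ {x} → f x ≡ x → OrbitLen f x 1
  OrbitLen-one fx≡x = z<s , fx≡x , λ { zero () ; (suc _) _ (s≤s ()) }

  OrbitLen-two : ∀ {x} → f x ≢ x → f (f x) ≡ x → OrbitLen f x 2
  OrbitLen-two fx≢x ffx≡x =
    z<s , ffx≡x , λ { zero () ; (suc zero) _ _ → fx≢x ; (suc (suc _)) _ (s≤s (s≤s ())) }

OrbitLen-conj : ∀ {m m'} {f : Fin m → Fin m} {g : Fin m' → Fin m'} (h : Fin m → Fin m') →
                (∀ {x y} → h x ≡ h y → x ≡ y) → (∀ x → g (h x) ≡ h (f x)) →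
                ∀ {x k} → OrbitLen f x k → OrbitLen g (h x) k
OrbitLen-conj {f = f} h h-injective comm {x} {k} (0<k , fixed , minimal) =
  0<k , trans (iter-conj f h comm k x) (cong h fixed) ,
  λ j 0<j j<k fixed-j → minimal j 0<j j<k (h-injective (trans (sym (iter-conj f h comm j x)) fixed-j))

-- A face of φ = σ ∘ α of degree dividing 4; its white ends keep it off the boundary circle.
record WhiteSquare {m n : ℕ} (σ α : Fin m → Fin m) (kind : Fin m → Kind n)
                   (d₀ d₁ d₂ d₃ : Fin m) : Set where
  field
    step₀  : σ (α d₀) ≡ d₁
    step₁  : σ (α d₁) ≡ d₂
    step₂  : σ (α d₂) ≡ d₃
    step₃  : σ (α d₃) ≡ d₀
    white₀ : kind d₀ ≡ white
    white₁ : kind (α d₁) ≡ white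
    white₂ : kind d₂ ≡ white
    white₃ : kind (α d₃) ≡ white

module _ {n : ℕ} (G : PlabicGraph n) where
  open PlabicGraph G

  σ-injective : ∀ {x y} → σ x ≡ σ y → x ≡ y
  σ-injective {x} {y} eq = trans (sym (σ⁻σ x)) (trans (cong σ⁻ eq) (σ⁻σ y))

  α-injective : ∀ {x y} → α x ≡ α y → x ≡ y
  α-injective {x} {y} eq = trans (sym (α-invol x)) (trans (cong α eq) (α-invol y))

  white≢black-dart : ∀ {x y} → kind x ≡ white → kind y ≡ black → x ≢ y
  white≢black-dart kx ky refl with trans (sym kx) ky
  ... | ()

  black≢white-dart : ∀ {x y} → kind x ≡ black → kind y ≡ white → x ≢ y
  black≢white-dart kx ky = ≢-sym (white≢black-dart ky kx)

  white-σ³ : ∀ {d} → kind d ≡ white → σ (σ (σ d)) ≡ d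
  white-σ³ kd with white-deg _ kd
  ... | _ , σ³d≡d , _ = σ³d≡d

  white-σ≢ : ∀ {d} → kind d ≡ white → σ d ≢ d
  white-σ≢ kd with white-deg _ kd
  ... | _ , _ , minimal = minimal 1 z<s (s≤s (s≤s z≤n))

  white-σσ≢ : ∀ {d} → kind d ≡ white → σ (σ d) ≢ d
  white-σσ≢ kd with white-deg _ kd
  ... | _ , _ , minimal = minimal 2 z<s (s≤s (s≤s (s≤s z≤n)))

  white-σσ≢σ : ∀ {d} → kind d ≡ white → σ (σ d) ≢ σ d
  white-σσ≢σ kd = white-σ≢ kd ∘ σ-injective

  white-notCircle : ∀ {d} → kind d ≡ white → isCircleDart G d ≡ false
  white-notCircle kd rewrite kd = refl

  αwhite-notCircle : ∀ {d} → kind (α d) ≡ white → isCircleDart G d ≡ false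
  αwhite-notCircle {d} kαd rewrite kαd = ∧-zeroʳ (onCircle (kind d))

module _ {n : ℕ} (G G' : PlabicGraph n) {σ₀ α₀ : Fin (PlabicGraph.m G) → Fin (PlabicGraph.m G)}
         {kind₀ : Fin (PlabicGraph.m G) → Kind n} (R : Realizes G G' σ₀ α₀ kind₀) where
  open PlabicGraph G'

  relabel : Fin (PlabicGraph.m G) → Fin m
  relabel = Inverse.to (proj₁ R)

  σ-relabel : ∀ d → σ (relabel d) ≡ relabel (σ₀ d)
  σ-relabel d = proj₁ (proj₂ R d)

  α-relabel : ∀ d → α (relabel d) ≡ relabel (α₀ d)
  α-relabel d = proj₁ (proj₂ (proj₂ R d))

  kind-relabel : ∀ d → kind (relabel d) ≡ kind₀ d
  kind-relabel d = proj₂ (proj₂ (proj₂ R d))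

  OrbitLen-relabel : ∀ {d k} → OrbitLen σ₀ d k → OrbitLen σ (relabel d) k
  OrbitLen-relabel = OrbitLen-conj relabel (Injection.injective (↔⇒↣ (proj₁ R))) σ-relabel

  WhiteSquare-relabel : ∀ {d₀ d₁ d₂ d₃} → WhiteSquare σ₀ α₀ kind₀ d₀ d₁ d₂ d₃ →
                        WhiteSquare σ α kind (relabel d₀) (relabel d₁) (relabel d₂) (relabel d₃)
  WhiteSquare-relabel square = record
    { step₀  = φ-relabel step₀
    ; step₁  = φ-relabel step₁
    ; step₂  = φ-relabel step₂
    ; step₃  = φ-relabel step₃
    ; white₀ = trans (kind-relabel _) white₀
    ; white₁ = αkind-relabel white₁
    ; white₂ = trans (kind-relabel _) white₂
    ; white₃ = αkind-relabel white₃
    }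
    where
    open WhiteSquare square
    φ-relabel : ∀ {x y} → σ₀ (α₀ x) ≡ y → σ (α (relabel x)) ≡ relabel y
    φ-relabel {x} eq = trans (cong σ (α-relabel x)) (trans (σ-relabel (α₀ x)) (cong relabel eq))
    αkind-relabel : ∀ {x} → kind₀ (α₀ x) ≡ white → kind (α (relabel x)) ≡ white
    αkind-relabel {x} eq = trans (cong kind (α-relabel x)) (trans (kind-relabel (α₀ x)) eq)

module _ {n : ℕ} (G : PlabicGraph n) (p : Fin (PlabicGraph.m G)) where
  open PlabicGraph G
  open UR G p

  urbanRenewal-sourceSquare : URCondition → WhiteSquare σ α kind p e2 e3 e4
  urbanRenewal-sourceSquare (kp , kr , σv≡p , _) = record
    { step₀  = refl
    ; step₁  = refl
    ; step₂  = refl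
    ; step₃  = σv≡p
    ; white₀ = kp
    ; white₁ = kr
    ; white₂ = trans (kind-σ r) kr
    ; white₃ = trans (sym (kind-σ v)) (trans (cong kind σv≡p) kp)
    }

  module _ (kp : kind p ≡ white) (kr : kind r ≡ white) (σv≡p : σ v ≡ p)
           (r≢p : r ≢ p) (r≢a : r ≢ a) (r≢v : r ≢ v) where
    private
      ka : kind a ≡ white
      ka = trans (kind-σ p) kp
      kv : kind v ≡ white
      kv = trans (sym (kind-σ v)) (trans (cong kind σv≡p) kp)
      ke3 : kind e3 ≡ white
      ke3 = trans (kind-σ r) kr
      kb : kind b ≡ white
      kb = trans (kind-σ e3) ke3
      kq : kind q ≡ black
      kq = white-black p kp
      ka' : kind a' ≡ black
      ka' = white-black a ka
      kb' : kind b' ≡ black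
      kb' = white-black b kb
      ku : kind u ≡ black
      ku = white-black e3 ke3
      ke2 : kind e2 ≡ black
      ke2 = trans (kind-σ q) kq
      ke4 : kind e4 ≡ black
      ke4 = trans (kind-σ u) ku

      v≡σσp : v ≡ σ (σ p)
      v≡σσp = σ-injective G (trans σv≡p (sym (white-σ³ G kp)))

      a≢p : a ≢ p
      a≢p = white-σ≢ G kp
      v≢p : v ≢ p
      v≢p = white-σσ≢ G kp ∘ trans (sym v≡σσp)
      v≢a : v ≢ a
      v≢a = white-σσ≢σ G kp ∘ trans (sym v≡σσp)
      b≢r : b ≢ r
      b≢r = white-σσ≢ G kr
      b≢e3 : b ≢ e3
      b≢e3 = white-σσ≢σ G kr

      -- r, e3, b is the σ-orbit of the second white vertex, disjoint from the orbit p, a, v of the first.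
      r∉p-vertex : ¬ OnTriangle σ (σ-injective G) (white-σ³ G kp) r
      r∉p-vertex (inj₁ r≡p)              = r≢p r≡p
      r∉p-vertex (inj₂ (inj₁ r≡a))       = r≢a r≡a
      r∉p-vertex (inj₂ (inj₂ r≡σσp))     = r≢v (trans r≡σσp (sym v≡σσp))
      e3∉p-vertex : ¬ OnTriangle σ (σ-injective G) (white-σ³ G kp) e3
      e3∉p-vertex = r∉p-vertex ∘ onTriangle-pred σ (σ-injective G) (white-σ³ G kp)
      b∉p-vertex : ¬ OnTriangle σ (σ-injective G) (white-σ³ G kp) b
      b∉p-vertex = e3∉p-vertex ∘ onTriangle-pred σ (σ-injective G) (white-σ³ G kp)

      b≢p : b ≢ p
      b≢p = b∉p-vertex ∘ inj₁
      b≢a : b ≢ a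
      b≢a = b∉p-vertex ∘ inj₂ ∘ inj₁
      b≢v : b ≢ v
      b≢v b≡v = b∉p-vertex (inj₂ (inj₂ (trans b≡v v≡σσp)))
      e3≢v : e3 ≢ v
      e3≢v e3≡v = e3∉p-vertex (inj₂ (inj₂ (trans e3≡v v≡σσp)))

      b'≢q : b' ≢ q
      b'≢q = b≢p ∘ α-injective G
      b'≢a' : b' ≢ a'
      b'≢a' = b≢a ∘ α-injective G
      b'≢e4 : b' ≢ e4
      b'≢e4 b'≡e4 = b≢v (α-injective G (trans b'≡e4 (sym (α-invol e4))))
      b'≢u : b' ≢ u
      b'≢u = b≢e3 ∘ α-injective G
      a'≢q : a' ≢ q
      a'≢q = a≢p ∘ α-injective G
      e4≢e2 : e4 ≢ e2
      e4≢e2 e4≡e2 = r≢v (sym (α-injective G (trans (α-invol e4) (trans e4≡e2 (sym (α-invol e2))))))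

      w≢b = white≢black-dart G
      b≢w = black≢white-dart G

      α₀r : α₀ r ≡ e4
      α₀r rewrite ≢⇒==-false r≢p | ≢⇒==-false (w≢b kr kq) | ≢⇒==-false r≢a
                | ≢⇒==-false (w≢b kr ka') | ==-refl r = refl
      σ₀e4 : σ₀ e4 ≡ b'
      σ₀e4 rewrite ≢⇒==-false (b≢w ke4 kp) | ≢⇒==-false (b≢w ke4 ka) | ≢⇒==-false (b≢w ke4 kr)
                 | ≢⇒==-false (b≢w ke4 ke3) | ≢⇒==-false (b≢w ke4 kb) | ≢⇒==-false (b≢w ke4 kv)
                 | ≢⇒==-false e4≢e2 | ==-refl e4 = refl
      α₀b' : α₀ b' ≡ b
      α₀b' rewrite ≢⇒==-false (b≢w kb' kp) | ≢⇒==-false b'≢q | ≢⇒==-false (b≢w kb' ka)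
                 | ≢⇒==-false b'≢a' | ≢⇒==-false (b≢w kb' kr) | ≢⇒==-false b'≢e4
                 | ≢⇒==-false (b≢w kb' ke3) | ≢⇒==-false b'≢u | ≢⇒==-false (b≢w kb' kb)
                 | ==-refl b' = refl
      σ₀b : σ₀ b ≡ v
      σ₀b rewrite ≢⇒==-false b≢p | ≢⇒==-false b≢a | ≢⇒==-false b≢r | ≢⇒==-false b≢e3
                | ==-refl b = refl
      α₀v : α₀ v ≡ e2
      α₀v rewrite ≢⇒==-false v≢p | ≢⇒==-false (w≢b kv kq) | ≢⇒==-false v≢a
                | ≢⇒==-false (w≢b kv ka') | ≢⇒==-false (≢-sym r≢v) | ≢⇒==-false (w≢b kv ke4)
                | ≢⇒==-false (≢-sym e3≢v) | ≢⇒==-false (w≢b kv ku) | ≢⇒==-false (≢-sym b≢v)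
                | ≢⇒==-false (w≢b kv kb') | ==-refl v = refl
      σ₀e2 : σ₀ e2 ≡ a'
      σ₀e2 rewrite ≢⇒==-false (b≢w ke2 kp) | ≢⇒==-false (b≢w ke2 ka) | ≢⇒==-false (b≢w ke2 kr)
                 | ≢⇒==-false (b≢w ke2 ke3) | ≢⇒==-false (b≢w ke2 kb) | ≢⇒==-false (b≢w ke2 kv)
                 | ==-refl e2 = refl
      α₀a' : α₀ a' ≡ a
      α₀a' rewrite ≢⇒==-false (b≢w ka' kp) | ≢⇒==-false a'≢q | ≢⇒==-false (b≢w ka' ka)
                 | ==-refl a' = refl
      σ₀a : σ₀ a ≡ r
      σ₀a rewrite ≢⇒==-false a≢p | ==-refl a = refl

      kind₀r : kind₀ r ≡ white
      kind₀r rewrite ≢⇒==-false r≢p | ≢⇒==-false r≢a | ==-refl r = refl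
      kind₀b : kind₀ b ≡ white
      kind₀b rewrite ≢⇒==-false b≢p | ≢⇒==-false b≢a | ≢⇒==-false b≢r | ≢⇒==-false b≢e3
                   | ==-refl b = refl
      kind₀v : kind₀ v ≡ white
      kind₀v rewrite ≢⇒==-false v≢p | ≢⇒==-false v≢a | ≢⇒==-false (≢-sym r≢v)
                   | ≢⇒==-false (≢-sym e3≢v) | ≢⇒==-false (≢-sym b≢v) | ==-refl v = refl
      kind₀a : kind₀ a ≡ white
      kind₀a rewrite ≢⇒==-false a≢p | ==-refl a = refl

    urbanRenewal-targetSquare : WhiteSquare σ₀ α₀ kind₀ r b' v a'
    urbanRenewal-targetSquare = record
      { step₀  = trans (cong σ₀ α₀r) σ₀e4
      ; step₁  = trans (cong σ₀ α₀b') σ₀b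
      ; step₂  = trans (cong σ₀ α₀v) σ₀e2
      ; step₃  = trans (cong σ₀ α₀a') σ₀a
      ; white₀ = kind₀r
      ; white₁ = trans (cong kind₀ α₀b') kind₀b
      ; white₂ = kind₀v
      ; white₃ = trans (cong kind₀ α₀a') kind₀a
      }

module _ {n : ℕ} (G : PlabicGraph n) (m1 : Fin (PlabicGraph.m G)) where
  open PlabicGraph G
  open FL G m1

  flip-keepsBlackDegTwo : FlipCondition → OrbitLen σ₀ m1 2
  flip-keepsBlackDegTwo (km1 , (_ , σσm1≡m1 , minimal) , kc1 , kc2 , _) =
    OrbitLen-two σ₀ (minimal 1 z<s (s≤s (s≤s z≤n)) ∘ trans (sym (σ₀-black km1)))
                    (trans (cong σ₀ (σ₀-black km1)) (trans (σ₀-black (trans (kind-σ m1) km1)) σσm1≡m1))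
    where
    kdt : kind dt ≡ white
    kdt = trans (kind-σ c1) kc1
    kdr : kind dr ≡ white
    kdr = trans (kind-σ dt) kdt
    kds : kind ds ≡ white
    kds = trans (kind-σ c2) kc2
    kdl : kind dl ≡ white
    kdl = trans (kind-σ ds) kds
    σ₀-black : ∀ {d} → kind d ≡ black → σ₀ d ≡ σ d
    σ₀-black kd rewrite ≢⇒==-false (black≢white-dart G kd kc1) | ≢⇒==-false (black≢white-dart G kd kdl)
                      | ≢⇒==-false (black≢white-dart G kd kdt) | ≢⇒==-false (black≢white-dart G kd kc2)
                      | ≢⇒==-false (black≢white-dart G kd kdr) | ≢⇒==-false (black≢white-dart G kd kds) = refl

module AugmentedWeb {n : ℕ} (W : PlabicGraph n) (aw : IsAugmentedWeb W) where
  open PlabicGraph W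

  noShortInteriorFace :
    ∀ {d} p → 0 < p → p ≤ 5 → iter (φ W) p d ≡ d →
    (∀ j → j < p → isCircleDart W (iter (φ W) j d) ≡ false) → ⊥
  noShortInteriorFace {d} p 0<p p≤5 fixed nonCircle with orbitLen-≤ (φ W) p 0<p fixed
  ... | k , k≤p , orbit = 1+n≰n (≤-trans (proj₁ aw d k interior orbit) (≤-trans k≤p p≤5))
    where
    interior : InteriorFace W d
    interior i with iter-periodic (φ W) 0<p fixed i
    ... | j , j<p , eq = trans (cong (isCircleDart W) eq) (nonCircle j j<p)

  noWhiteSquare : ∀ {d₀ d₁ d₂ d₃} → ¬ WhiteSquare σ α kind d₀ d₁ d₂ d₃
  noWhiteSquare {d₀} {d₁} {d₂} {d₃} square =
    noShortInteriorFace 4 z<s (s≤s (s≤s (s≤s (s≤s z≤n)))) at₄ nonCircle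
    where
    open WhiteSquare square
    at₂ : iter (φ W) 2 d₀ ≡ d₂
    at₂ = trans (cong (φ W) step₀) step₁
    at₃ : iter (φ W) 3 d₀ ≡ d₃
    at₃ = trans (cong (φ W) at₂) step₂
    at₄ : iter (φ W) 4 d₀ ≡ d₀
    at₄ = trans (cong (φ W) at₃) step₃
    nonCircle : ∀ j → j < 4 → isCircleDart W (iter (φ W) j d₀) ≡ false
    nonCircle 0 _ = white-notCircle W white₀
    nonCircle 1 _ = trans (cong (isCircleDart W) step₀) (αwhite-notCircle W white₁)
    nonCircle 2 _ = trans (cong (isCircleDart W) at₂) (white-notCircle W white₂)
    nonCircle 3 _ = trans (cong (isCircleDart W) at₃) (αwhite-notCircle W white₃)
    nonCircle (suc (suc (suc (suc _)))) (s≤s (s≤s (s≤s (s≤s ()))))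

  noBlackDegTwo : ∀ {d} → kind d ≡ black → ¬ OrbitLen σ d 2
  noBlackDegTwo kd orbit = 1+n≰n (proj₂ aw _ 2 kd orbit)

  noDegTwoFace : ¬ HasDegTwoFace W
  noDegTwoFace (d , interior , orbit) with proj₁ aw d 2 interior orbit
  ... | s≤s (s≤s ())

  noInteriorLeaf : ¬ HasInteriorLeaf W
  noInteriorLeaf (d , inj₁ kd , σd≡d , _) = 1+n≰n (≤-trans (proj₂ aw d 1 kd (OrbitLen-one σ σd≡d)) (s≤s z≤n))
  noInteriorLeaf (d , inj₂ kd , σd≡d , _) = white-σ≢ W kd σd≡d

  noMove : ∀ {G} → ¬ SymClosure Move W G
  noMove (fwd (inj₁ (p , cond , _))) =
    noWhiteSquare (urbanRenewal-sourceSquare W p cond)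
  noMove (fwd (inj₂ (_ , (km1 , orbit , _) , _))) =
    noBlackDegTwo km1 orbit
  noMove {G} (bwd (inj₁ (p , (kp , kr , σv≡p , r≢p , r≢a , r≢v) , R))) =
    noWhiteSquare
      (WhiteSquare-relabel G W R (urbanRenewal-targetSquare G p kp kr σv≡p r≢p r≢a r≢v))
  noMove {G} (bwd (inj₂ (m1 , cond , R))) =
    noBlackDegTwo (trans (kind-relabel G W R m1) (proj₁ cond))
      (OrbitLen-relabel G W R (flip-keepsBlackDegTwo G m1 cond))

  moveEquivalent⇒≡ : ∀ {G} → MoveEquivalent W G → W ≡ G
  moveEquivalent⇒≡ ε          = refl
  moveEquivalent⇒≡ (move ◅ _) = ⊥-elim (noMove move)

  reduced : Reduced W
  reduced G' W~G' with moveEquivalent⇒≡ W~G'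
  ... | refl = [ noDegTwoFace , noInteriorLeaf ]

mainTheorem7 : ∀ (n : ℕ) (e : ℤ) (W : PlabicGraph n) → AW n e W → Reduced W
mainTheorem7 n e W (aw , _) = AugmentedWeb.reduced W aw
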